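{- Let $\mathfrak{A}=\langle A,\sqcap,-,0,f\rangle$ be a normal and unit-preserving Boolean frame and suppose there are $a,b\in A$ with $a\neq0$, $b\neq0$ and $f(a)\sqcap f(b)=0$. Then $\mathfrak{A}^*$ does not have the congruence extension property.
   Context: A Boolean frame is an algebra $\langle A,\sqcap,-,0,f\rangle$ with $\langle A,\sqcap,-,0\rangle$ a Boolean algebra and $f:A\to A$ an arbitrary unary operation; it is normal if $f(0)=0$ and unit-preserving if $f(1)=1$. For a Boolean frame $\mathfrak{A}$, $\mathfrak{A}^*$ is the Boolean frame whose Boolean reduct is the direct product of two copies of the Boolean reduct of $\mathfrak{A}$ (universe $A\times A$) and whose operation is $f^*(\langle a,b\rangle)=\langle f(a),f(b)\rangle$ if $a=0$ or $b=0$, and $f^*(\langle a,b\rangle)=\langle1,1\rangle$ otherwise. An algebra has the congruence extension property if for every subalgebra $B$ and every congruence $\Theta$ of $B$ there is a congruence $\Psi$ of the algebra with $\Psi\cap(B\times B)=\Theta$. -}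

module Defs where

open import Level using (Level; _⊔_; suc)
open import Data.Product using (Σ; _×_; _,_; proj₁; proj₂; ∃)
open import Data.Sum using (_⊎_)
open import Relation.Nullary using (¬_)
open import Relation.Binary using (Rel; IsEquivalence)
open import Relation.Unary using (Pred)
open import Algebra.Core using (Op₁; Op₂)
open import Algebra.Lattice.Bundles using (BooleanAlgebra)

record RawFrame c ℓ : Set (suc (c ⊔ ℓ)) where
  field
    Carrier : Set c
    _≈_     : Rel Carrier ℓ
    _⊓_     : Op₂ Carrier
    -_      : Op₁ Carrier
    𝟘       : Carrier
    f       : Op₁ Carrier

record BooleanFrame c ℓ : Set (suc (c ⊔ ℓ)) where
  field
    boolAlg : BooleanAlgebra c ℓ
  open BooleanAlgebra boolAlg public renaming (¬_ to ∁_)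
  field
    f      : Op₁ Carrier
    f-cong : ∀ {x y} → x ≈ y → f x ≈ f y

  raw : RawFrame c ℓ
  raw = record { Carrier = Carrier ; _≈_ = _≈_ ; _⊓_ = _∧_ ; -_ = ∁_ ; 𝟘 = ⊥ ; f = f }

Normal : ∀ {c ℓ} → BooleanFrame c ℓ → Set ℓ
Normal 𝔄 = f ⊥ ≈ ⊥ where open BooleanFrame 𝔄

UnitPreserving : ∀ {c ℓ} → BooleanFrame c ℓ → Set ℓ
UnitPreserving 𝔄 = f ⊤ ≈ ⊤ where open BooleanFrame 𝔄

module _ {c ℓ} (R : RawFrame c ℓ) where
  open RawFrame R

  record IsSubalgebra (B : Pred Carrier (c ⊔ ℓ)) : Set (c ⊔ ℓ) where
    field
      ⊓-closed : ∀ {x y} → B x → B y → B (x ⊓ y)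
      neg-closed : ∀ {x} → B x → B (- x)
      𝟘-closed : B 𝟘
      f-closed : ∀ {x} → B x → B (f x)

  record IsSubCongruence (B : Pred Carrier (c ⊔ ℓ)) (SB : IsSubalgebra B)
           (Θ : Rel (Σ Carrier B) (c ⊔ ℓ)) : Set (c ⊔ ℓ) where
    open IsSubalgebra SB
    field
      isEquivalence : IsEquivalence Θ
      ≈⊆Θ   : ∀ {x y : Σ Carrier B} → proj₁ x ≈ proj₁ y → Θ x y
      ⊓-cong : ∀ {x x' y y' : Σ Carrier B} → Θ x x' → Θ y y' →
               Θ (proj₁ x ⊓ proj₁ y , ⊓-closed (proj₂ x) (proj₂ y))
                 (proj₁ x' ⊓ proj₁ y' , ⊓-closed (proj₂ x') (proj₂ y'))
      neg-cong : ∀ {x x' : Σ Carrier B} → Θ x x' →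
               Θ (- proj₁ x , neg-closed (proj₂ x)) (- proj₁ x' , neg-closed (proj₂ x'))
      f-cong : ∀ {x x' : Σ Carrier B} → Θ x x' →
               Θ (f (proj₁ x) , f-closed (proj₂ x)) (f (proj₁ x') , f-closed (proj₂ x'))

  record IsCongruence (Ψ : Rel Carrier (c ⊔ ℓ)) : Set (c ⊔ ℓ) where
    field
      isEquivalence : IsEquivalence Ψ
      ≈⊆Ψ    : ∀ {x y} → x ≈ y → Ψ x y
      ⊓-cong : ∀ {x x' y y'} → Ψ x x' → Ψ y y' → Ψ (x ⊓ y) (x' ⊓ y')
      neg-cong : ∀ {x x'} → Ψ x x' → Ψ (- x) (- x')
      f-cong : ∀ {x x'} → Ψ x x' → Ψ (f x) (f x')

  CEP : Set (suc (c ⊔ ℓ))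
  CEP = ∀ (B : Pred Carrier (c ⊔ ℓ)) (SB : IsSubalgebra B)
          (Θ : Rel (Σ Carrier B) (c ⊔ ℓ)) → IsSubCongruence B SB Θ →
          ∃ λ (Ψ : Rel Carrier (c ⊔ ℓ)) → IsCongruence Ψ ×
            (∀ (x y : Σ Carrier B) → (Ψ (proj₁ x) (proj₁ y) → Θ x y) × (Θ x y → Ψ (proj₁ x) (proj₁ y)))

module _ {c ℓ} (𝔄 : BooleanFrame c ℓ) where
  open BooleanFrame 𝔄

  _≈²_ : Rel (Carrier × Carrier) ℓ
  (a , b) ≈² (a' , b') = (a ≈ a') × (b ≈ b')

  -- Specification of f* (it is defined by a classical case distinction, so we
  -- take it as any operation satisfying its defining equations).
  IsStarOp : Op₁ (Carrier × Carrier) → Set (c ⊔ ℓ)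
  IsStarOp g =
    (∀ a b → (a ≈ ⊥ ⊎ b ≈ ⊥) → g (a , b) ≈² (f a , f b)) ×
    (∀ a b → ¬ (a ≈ ⊥) → ¬ (b ≈ ⊥) → g (a , b) ≈² (⊤ , ⊤))

  Star : Op₁ (Carrier × Carrier) → RawFrame c ℓ
  Star g = record
    { Carrier = Carrier × Carrier
    ; _≈_ = _≈²_
    ; _⊓_ = λ { (a , b) (a' , b') → (a ∧ a' , b ∧ b') }
    ; -_ = λ { (a , b) → (∁ a , ∁ b) }
    ; 𝟘 = (⊥ , ⊥)
    ; f = g
    }

{-# OPTIONS --safe #-}
module Submission where

-- In 𝔄* take the subalgebra B of pairs whose first coordinate is 0 or 1. On B the first
-- coordinate of f*⟨x,y⟩ is f x (for x = 1 because f 1 = 1), so "same first coordinate" is a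
-- congruence Θ of B; it identifies ⟨0,b⟩ with ⟨0,0⟩. A congruence Ψ of 𝔄* extending Θ then
-- identifies ⟨x,b⟩ with ⟨x,0⟩ (join both with ⟨x,0⟩), and applying f* gives
-- ⟨1,1⟩ = f*⟨x,b⟩ Ψ f*⟨x,0⟩ = ⟨f x,0⟩ for x ≠ 0. Meeting the cases x = a and x = b yields
-- ⟨1,1⟩ Ψ ⟨f a ⊓ f b,0⟩ = ⟨0,0⟩, which Θ forbids.

open import Defs
open import Level using (Level; _⊔_; Lift; lift; lower)
open import Data.Product using (_×_; ∃; Σ; _,_; proj₁; proj₂; map₂)
open import Data.Sum using (_⊎_; inj₁; inj₂; [_,_]′)
import Data.Sum as Sum
open import Effect.Monad using (RawMonad)
open import Relation.Nullary using (¬_; Dec; yes; no)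
open import Relation.Nullary.Negation using (¬¬-Monad; ¬¬-map)
open import Relation.Nullary.Decidable using (¬¬-excluded-middle)
open import Relation.Binary using (Rel; IsEquivalence; Setoid)
open import Relation.Unary using (Pred)
open import Function using (_∘_)
open import Algebra.Core using (Op₁; Op₂)
open import Algebra.Lattice.Bundles using (BooleanAlgebra)
import Algebra.Lattice.Properties.BooleanAlgebra as BooleanAlgebraProperties
import Relation.Binary.Reasoning.Setoid as SetoidReasoning

module BoundElements {c ℓ} (𝔅 : BooleanAlgebra c ℓ) where
  open BooleanAlgebra 𝔅 renaming (¬_ to ∁_)
  open BooleanAlgebraProperties 𝔅

  IsBound : Carrier → Set ℓ
  IsBound x = x ≈ ⊥ ⊎ x ≈ ⊤

  IsBound-resp : ∀ {x y} → x ≈ y → IsBound x → IsBound y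
  IsBound-resp x≈y = Sum.map (trans (sym x≈y)) (trans (sym x≈y))

  ∧-bound : ∀ {x y} → IsBound x → IsBound y → IsBound (x ∧ y)
  ∧-bound {y = y} (inj₁ x≈⊥) _          = inj₁ (trans (∧-congʳ x≈⊥) (∧-zeroˡ y))
  ∧-bound {x = x} (inj₂ _)   (inj₁ y≈⊥) = inj₁ (trans (∧-congˡ y≈⊥) (∧-zeroʳ x))
  ∧-bound {y = y} (inj₂ x≈⊤) (inj₂ y≈⊤) = inj₂ (trans (∧-congʳ x≈⊤) (trans (∧-identityˡ y) y≈⊤))

  ∁-bound : ∀ {x} → IsBound x → IsBound (∁ x)
  ∁-bound (inj₁ x≈⊥) = inj₂ (trans (¬-cong x≈⊥) ¬⊥≈⊤)
  ∁-bound (inj₂ x≈⊤) = inj₁ (trans (¬-cong x≈⊤) ¬⊤≈⊥)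

  nonzero⇒⊤≉⊥ : ∀ {x} → ¬ x ≈ ⊥ → ¬ ⊤ ≈ ⊥
  nonzero⇒⊤≉⊥ {x} x≉⊥ ⊤≈⊥ = x≉⊥ (begin
    x      ≈⟨ ∧-identityʳ x ⟨
    x ∧ ⊤  ≈⟨ ∧-congˡ ⊤≈⊥ ⟩
    x ∧ ⊥  ≈⟨ ∧-zeroʳ x ⟩
    ⊥      ∎)
    where open SetoidReasoning setoid

  ∁[∁x∧∁y]≈x∨y : ∀ x y → ∁ (∁ x ∧ ∁ y) ≈ x ∨ y
  ∁[∁x∧∁y]≈x∨y x y = trans (deMorgan₁ (∁ x) (∁ y)) (∨-cong (¬-involutive x) (¬-involutive y))

module Join {c ℓ} (R : RawFrame c ℓ) where
  open RawFrame R

  join : Op₂ Carrier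
  join x y = - ((- x) ⊓ (- y))

  join-congˡ : ∀ {Ψ} → IsCongruence R Ψ → ∀ r {p q} → Ψ p q → Ψ (join r p) (join r q)
  join-congˡ Ψ-isCongruence r {p} {q} Ψpq =
    neg-cong (⊓-cong { - r} { - r} { - p} { - q} (IsEquivalence.refl isEquivalence) (neg-cong Ψpq))
    where open IsCongruence Ψ-isCongruence

module StarFrame {c ℓ} (𝔄 : BooleanFrame c ℓ) (g : Op₁ (BooleanFrame.Carrier 𝔄 × BooleanFrame.Carrier 𝔄))
                 (g-isStarOp : IsStarOp 𝔄 g) where
  open BooleanFrame 𝔄
  open BooleanAlgebraProperties boolAlg
  open BoundElements boolAlg
  open RawMonad (¬¬-Monad {ℓ})
  open Join (Star 𝔄 g)

  infix 4 _≋_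
  _≋_ : Rel (Carrier × Carrier) ℓ
  _≋_ = _≈²_ 𝔄

  f-bound : Normal 𝔄 → UnitPreserving 𝔄 → ∀ {x} → IsBound x → IsBound (f x)
  f-bound f⊥≈⊥ _     (inj₁ x≈⊥) = inj₁ (trans (f-cong x≈⊥) f⊥≈⊥)
  f-bound _     f⊤≈⊤ (inj₂ x≈⊤) = inj₂ (trans (f-cong x≈⊤) f⊤≈⊤)

  star-dichotomy : ∀ x y → ¬ ¬ (g (x , y) ≋ (f x , f y) ⊎ g (x , y) ≋ (⊤ , ⊤))
  star-dichotomy x y = ¬¬-map cases ¬¬-excluded-middle
    where
    cases : Dec (x ≈ ⊥ ⊎ y ≈ ⊥) → g (x , y) ≋ (f x , f y) ⊎ g (x , y) ≋ (⊤ , ⊤)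
    cases (yes zero)    = inj₁ (proj₁ g-isStarOp x y zero)
    cases (no nonzero)  = inj₂ (proj₂ g-isStarOp x y (nonzero ∘ inj₁) (nonzero ∘ inj₂))

  proj₁-star-bound : UnitPreserving 𝔄 → ∀ {x y} → IsBound x → ¬ ¬ (proj₁ (g (x , y)) ≈ f x)
  proj₁-star-bound _    {x} {y} (inj₁ x≈⊥) = return (proj₁ (proj₁ g-isStarOp x y (inj₁ x≈⊥)))
  proj₁-star-bound f⊤≈⊤ {x} {y} (inj₂ x≈⊤) =
    [ proj₁ , (λ g≈⊤ → trans (proj₁ g≈⊤) (sym (trans (f-cong x≈⊤) f⊤≈⊤))) ]′ <$> star-dichotomy x y

  -- B and Θ hold only under ¬¬: the first coordinate of f*⟨1,y⟩ is 1 in either case of the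
  -- undecidable y ≈ ⊥. Since the theorem is a negation, ¬¬-facts are enough.
  FirstBounded : Pred (Carrier × Carrier) (c ⊔ ℓ)
  FirstBounded (x , _) = Lift c (¬ ¬ IsBound x)

  firstBounded-isSubalgebra : Normal 𝔄 → UnitPreserving 𝔄 → IsSubalgebra (Star 𝔄 g) FirstBounded
  firstBounded-isSubalgebra f⊥≈⊥ f⊤≈⊤ = record
    { ⊓-closed   = λ bx by → lift (∧-bound <$> lower bx <*> lower by)
    ; neg-closed = λ bx → lift (∁-bound <$> lower bx)
    ; 𝟘-closed   = lift (return (inj₁ refl))
    ; f-closed   = λ bx → lift do
        bound ← lower bx
        g₁≈fx ← proj₁-star-bound f⊤≈⊤ bound
        return (IsBound-resp (sym g₁≈fx) (f-bound f⊥≈⊥ f⊤≈⊤ bound))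
    }

  ⊥-first ⊤-first : Carrier → Σ (Carrier × Carrier) FirstBounded
  ⊥-first y = (⊥ , y) , lift (return (inj₁ refl))
  ⊤-first y = (⊤ , y) , lift (return (inj₂ refl))

  SameFirst : Rel (Σ (Carrier × Carrier) FirstBounded) (c ⊔ ℓ)
  SameFirst ((x , _) , _) ((x′ , _) , _) = Lift c (¬ ¬ x ≈ x′)

  ⊥-first-sameFirst : ∀ y y′ → SameFirst (⊥-first y) (⊥-first y′)
  ⊥-first-sameFirst _ _ = lift (return refl)

  sameFirst-isSubCongruence : (f⊥≈⊥ : Normal 𝔄) (f⊤≈⊤ : UnitPreserving 𝔄) →
                              IsSubCongruence (Star 𝔄 g) FirstBounded
                                (firstBounded-isSubalgebra f⊥≈⊥ f⊤≈⊤) SameFirst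
  sameFirst-isSubCongruence _ f⊤≈⊤ = record
    { isEquivalence = record
        { refl  = lift (return refl)
        ; sym   = λ θ → lift (sym <$> lower θ)
        ; trans = λ θ θ′ → lift (trans <$> lower θ <*> lower θ′)
        }
    ; ≈⊆Θ      = λ p≈p′ → lift (return (proj₁ p≈p′))
    ; ⊓-cong   = λ θ θ′ → lift (∧-cong <$> lower θ <*> lower θ′)
    ; neg-cong = λ θ → lift (¬-cong <$> lower θ)
    ; f-cong   = λ { {_ , bx} {_ , bx′} θ → lift do
        x≈x′ ← lower θ
        bound ← lower bx
        bound′ ← lower bx′
        g₁≈fx ← proj₁-star-bound f⊤≈⊤ bound
        g₁′≈fx′ ← proj₁-star-bound f⊤≈⊤ bound′
        return (trans g₁≈fx (trans (f-cong x≈x′) (sym g₁′≈fx′))) }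
    }

  join-⊥ : ∀ x y → join (x , ⊥) (⊥ , y) ≋ (x , y)
  join-⊥ x y = trans (∁[∁x∧∁y]≈x∨y x ⊥) (∨-identityʳ x) , trans (∁[∁x∧∁y]≈x∨y ⊥ y) (∨-identityˡ y)

  module _ {Ψ : Rel (Carrier × Carrier) (c ⊔ ℓ)} (Ψ-isCongruence : IsCongruence (Star 𝔄 g) Ψ) where
    private
      module Ψ = IsCongruence Ψ-isCongruence

      Ψ-setoid : Setoid c (c ⊔ ℓ)
      Ψ-setoid = record { isEquivalence = Ψ.isEquivalence }

    open SetoidReasoning Ψ-setoid

    second-cong : ∀ {y y′} → Ψ (⊥ , y) (⊥ , y′) → ∀ x → Ψ (x , y) (x , y′)
    second-cong {y} {y′} Ψ⊥y⊥y′ x = begin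
      (x , y)                ≈⟨ Ψ.≈⊆Ψ (join-⊥ x y) ⟨
      join (x , ⊥) (⊥ , y)   ≈⟨ join-congˡ Ψ-isCongruence (x , ⊥) Ψ⊥y⊥y′ ⟩
      join (x , ⊥) (⊥ , y′)  ≈⟨ Ψ.≈⊆Ψ (join-⊥ x y′) ⟩
      (x , y′)               ∎

    ⊤⊤∼fx⊥ : Normal 𝔄 → ∀ {y} → ¬ y ≈ ⊥ → Ψ (⊥ , y) (⊥ , ⊥) →
             ∀ {x} → ¬ x ≈ ⊥ → Ψ (⊤ , ⊤) (f x , ⊥)
    ⊤⊤∼fx⊥ f⊥≈⊥ {y} y≉⊥ Ψ⊥y⊥⊥ {x} x≉⊥ = begin
      (⊤ , ⊤)    ≈⟨ Ψ.≈⊆Ψ (proj₂ g-isStarOp x y x≉⊥ y≉⊥) ⟨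
      g (x , y)  ≈⟨ Ψ.f-cong (second-cong Ψ⊥y⊥⊥ x) ⟩
      g (x , ⊥)  ≈⟨ Ψ.≈⊆Ψ (map₂ (λ g₂≈f⊥ → trans g₂≈f⊥ f⊥≈⊥)
                                  (proj₁ g-isStarOp x ⊥ (inj₂ refl))) ⟩
      (f x , ⊥)  ∎

    ⊤⊤∼⊥⊥ : Normal 𝔄 → ∀ {a b} → ¬ a ≈ ⊥ → ¬ b ≈ ⊥ → f a ∧ f b ≈ ⊥ →
            Ψ (⊥ , b) (⊥ , ⊥) → Ψ (⊤ , ⊤) (⊥ , ⊥)
    ⊤⊤∼⊥⊥ f⊥≈⊥ {a} {b} a≉⊥ b≉⊥ fa∧fb≈⊥ Ψ⊥b⊥⊥ = begin
      (⊤ , ⊤)                ≈⟨ Ψ.≈⊆Ψ (∧-idem ⊤ , ∧-idem ⊤) ⟨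
      (⊤ ∧ ⊤ , ⊤ ∧ ⊤)        ≈⟨ Ψ.⊓-cong {⊤ , ⊤} {f a , ⊥} {⊤ , ⊤} {f b , ⊥}
                                 (⊤⊤∼fx⊥ f⊥≈⊥ b≉⊥ Ψ⊥b⊥⊥ a≉⊥)
                                 (⊤⊤∼fx⊥ f⊥≈⊥ b≉⊥ Ψ⊥b⊥⊥ b≉⊥) ⟩
      (f a ∧ f b , ⊥ ∧ ⊥)    ≈⟨ Ψ.≈⊆Ψ (fa∧fb≈⊥ , ∧-idem ⊥) ⟩
      (⊥ , ⊥)                ∎

lemma2p12 : ∀ {c ℓ : Level} (𝔄 : BooleanFrame c ℓ) → Normal 𝔄 → UnitPreserving 𝔄 →
    (let open BooleanFrame 𝔄 in
      ∃ λ a → ∃ λ b → ¬ (a ≈ ⊥) × ¬ (b ≈ ⊥) × ((f a ∧ f b) ≈ ⊥)) →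
    ∀ fstar → IsStarOp 𝔄 fstar → ¬ CEP (Star 𝔄 fstar)
lemma2p12 𝔄 f⊥≈⊥ f⊤≈⊤ (a , b , a≉⊥ , b≉⊥ , fa∧fb≈⊥) g g-isStarOp cep =
  let Ψ , Ψ-isCongruence , Ψ↾B⇔Θ = cep FirstBounded (firstBounded-isSubalgebra f⊥≈⊥ f⊤≈⊤)
                                        SameFirst (sameFirst-isSubCongruence f⊥≈⊥ f⊤≈⊤)
      Ψ⊥b⊥⊥ = proj₂ (Ψ↾B⇔Θ (⊥-first b) (⊥-first ⊥)) (⊥-first-sameFirst b ⊥)
      Ψ⊤⊤⊥⊥ = ⊤⊤∼⊥⊥ Ψ-isCongruence f⊥≈⊥ a≉⊥ b≉⊥ fa∧fb≈⊥ Ψ⊥b⊥⊥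
  in lower (proj₁ (Ψ↾B⇔Θ (⊤-first ⊤) (⊥-first ⊥)) Ψ⊤⊤⊥⊥) (nonzero⇒⊤≉⊥ a≉⊥)
  where
  open BooleanFrame 𝔄
  open BoundElements boolAlg using (nonzero⇒⊤≉⊥)
  open StarFrame 𝔄 g g-isStarOp
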